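{- Let $P,Q,R$ be arbitrary integers and let $(G_n)_{n\ge 0}$ be the Generalized Tribonacci sequence defined by $G_{n+3}=PG_{n+2}+QG_{n+1}+RG_n$ with $G_0=0$, $G_1=0$, $G_2=1$. Let $n\ge 1$, $w=e^{2\pi i/n}$, and let $C_n(G)=\mathrm{circ}(G_1,G_2,\ldots,G_n)$ be the $n\times n$ circulant matrix whose first row is $(G_1,G_2,\ldots,G_n)$ and each subsequent row is the cyclic right shift of the preceding one. Then for $j=0,1,\ldots,n-1$ the eigenvalues of $C_n(G)$ are \[ \lambda_j(C_n(G))=\frac{G_{n+1}+\left(G_{n+2}-PG_{n+1}-1\right)w^{ -j}+RG_n w^{ -2j}}{Pw^{ -j}+Qw^{ -2j}+Rw^{ -3j}-1}, \] for every $j$ for which the denominator $Pw^{ -j}+Qw^{ -2j}+Rw^{ -3j}-1$ is nonzero.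
   Context: For $a_0,\dots,a_{n-1}\in\mathbb{C}$, $\mathrm{circ}(a_0,\ldots,a_{n-1})$ denotes the $n\times n$ matrix $[c_{ij}]$ with $c_{ij}=a_{j-i}$ if $j\ge i$ and $c_{ij}=a_{n+j-i}$ if $j<i$; its $j$-th eigenvalue is indexed as $\lambda_j=\sum_{k=0}^{n-1}a_k w^{ -jk}$. -}

module Defs where

open import Level using (Level; _⊔_)
open import Algebra.Bundles using (CommutativeRing)
open import Data.Nat as ℕ using (ℕ; zero; suc)
open import Data.Integer as ℤ using (ℤ; +_; -[1+_])
open import Data.Fin as Fin using (Fin; toℕ)
open import Relation.Nullary using (¬_)
open import Data.Product using (_×_)

-- A field: a commutative ring with 0 ≠ 1 and a multiplicative inverse
-- for every nonzero element (the value of _⁻¹ at 0 is irrelevant).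
record Field (c ℓ : Level) : Set (Level.suc (c ⊔ ℓ)) where
  field
    commRing : CommutativeRing c ℓ
  open CommutativeRing commRing public
  field
    _⁻¹     : Carrier → Carrier
    inverse : ∀ x → ¬ (x ≈ 0#) → x * (x ⁻¹) ≈ 1#
    0≉1     : ¬ (0# ≈ 1#)

module FieldOps {c ℓ : Level} (F : Field c ℓ) where
  open Field F hiding (zero)

  _^_ : Carrier → ℕ → Carrier
  x ^ zero  = 1#
  x ^ suc n = x * (x ^ n)

  ℕ↑ : ℕ → Carrier
  ℕ↑ zero    = 0#
  ℕ↑ (suc n) = 1# + ℕ↑ n

  ℤ↑ : ℤ → Carrier
  ℤ↑ (+ n)      = ℕ↑ n
  ℤ↑ -[1+ n ]   = - (ℕ↑ (suc n))

  CharZero : Set ℓ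
  CharZero = ∀ n → ¬ (ℕ↑ (suc n) ≈ 0#)

  PrimitiveRoot : ℕ → Carrier → Set ℓ
  PrimitiveRoot n w = (w ^ n ≈ 1#) × (∀ k → 0 ℕ.< k → k ℕ.< n → ¬ (w ^ k ≈ 1#))

  Σ : ∀ {n} → (Fin n → Carrier) → Carrier
  Σ {zero}  f = 0#
  Σ {suc n} f = f Fin.zero + Σ (λ k → f (Fin.suc k))

  -- the j-th eigenvalue of circ(a_0,...,a_{n-1}) w.r.t. the root w:
  -- λ_j = Σ_{k=0}^{n-1} a_k w^{-jk}
  circEigenvalue : ∀ {n} → (Fin n → Carrier) → Carrier → Fin n → Carrier
  circEigenvalue a w j = Σ (λ k → a k * ((w ⁻¹) ^ (toℕ j ℕ.* toℕ k)))

G : ℤ → ℤ → ℤ → ℕ → ℤ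
G P Q R 0 = + 0
G P Q R 1 = + 0
G P Q R 2 = + 1
G P Q R (suc (suc (suc n))) =
  P ℤ.* G P Q R (suc (suc n)) ℤ.+ Q ℤ.* G P Q R (suc n) ℤ.+ R ℤ.* G P Q R n

{-# OPTIONS --safe #-}
module Submission where

-- With x = w⁻ʲ we have xⁿ = 1 and λⱼ = Σ_{k<n} G_{k+1} xᵏ. Put
-- D = P x + Q x² + R x³ − 1 and V_a = G_{a+1} + (G_{a+2} − P G_{a+1}) x + R G_a x².
-- The recurrence gives G_{a+1} D = x V_{a+1} − V_a, so λⱼ D telescopes to
-- xⁿ V_n − V_0 = V_n − x, using G_0 = G_1 = 0 and G_2 = 1; divide by D.

open import Defs
open import Level using (Level)
open import Data.Nat as ℕ using (ℕ; zero; suc)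
import Data.Nat.Properties as ℕ
open import Data.Integer as ℤ using (ℤ; +_; -[1+_]; _⊖_; _◃_)
import Data.Integer.Properties as ℤ
import Data.Sign as Sign
open import Data.Fin using (Fin; toℕ)
open import Data.Maybe using (Maybe; just; nothing)
open import Data.Product using (_,_)
open import Relation.Nullary using (¬_; yes; no)
open import Relation.Binary.PropositionalEquality as ≡ using (_≡_)
import Algebra.Properties.CommutativeSemigroup
open import Algebra.Solver.Ring.AlmostCommutativeRing
  using (fromCommutativeRing; _-Raw-AlmostCommutative⟶_)

module FieldTheory {c ℓ : Level} (F : Field c ℓ) where
  open Field F hiding (zero)
  open FieldOps F
  open import Relation.Binary.Reasoning.Setoid setoid
  open import Algebra.Properties.Ring ring using (-‿distribˡ-*; -‿distribʳ-*)
  open import Algebra.Properties.AbelianGroup +-abelianGroup using (ε⁻¹≈ε; ⁻¹-∙-comm)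
  open import Algebra.Properties.Group +-group using (⁻¹-involutive)
  open import Algebra.Properties.CommutativeSemigroup +-commutativeSemigroup
    using (interchange)
  module * = Algebra.Properties.CommutativeSemigroup *-commutativeSemigroup
  open import Algebra.Properties.Monoid.Mult +-monoid using (_×_; ×-homo-+)
  open import Algebra.Properties.Semiring.Mult semiring using (×1-homo-*)

  ℕ↑≡×1 : ∀ n → ℕ↑ n ≡ n × 1#
  ℕ↑≡×1 zero    = ≡.refl
  ℕ↑≡×1 (suc n) = ≡.cong (_+_ 1#) (ℕ↑≡×1 n)

  ℕ↑-+ : ∀ m n → ℕ↑ (m ℕ.+ n) ≈ ℕ↑ m + ℕ↑ n
  ℕ↑-+ m n rewrite ℕ↑≡×1 (m ℕ.+ n) | ℕ↑≡×1 m | ℕ↑≡×1 n = ×-homo-+ 1# m n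

  ℕ↑-* : ∀ m n → ℕ↑ (m ℕ.* n) ≈ ℕ↑ m * ℕ↑ n
  ℕ↑-* m n rewrite ℕ↑≡×1 (m ℕ.* n) | ℕ↑≡×1 m | ℕ↑≡×1 n = ×1-homo-* m n

  ℤ↑-⊖ : ∀ m n → ℤ↑ (m ⊖ n) ≈ ℕ↑ m - ℕ↑ n
  ℤ↑-⊖ m zero = begin
    ℤ↑ (m ⊖ 0)   ≡⟨ ≡.cong ℤ↑ (ℤ.⊖-≥ {m} ℕ.z≤n) ⟩
    ℕ↑ m         ≈⟨ +-identityʳ (ℕ↑ m) ⟨
    ℕ↑ m + 0#    ≈⟨ +-congˡ ε⁻¹≈ε ⟨
    ℕ↑ m - 0#    ∎
  ℤ↑-⊖ zero (suc n) = sym (+-identityˡ _)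
  ℤ↑-⊖ (suc m) (suc n) = begin
    ℤ↑ (suc m ⊖ suc n)             ≡⟨ ≡.cong ℤ↑ (ℤ.[1+m]⊖[1+n]≡m⊖n m n) ⟩
    ℤ↑ (m ⊖ n)                     ≈⟨ ℤ↑-⊖ m n ⟩
    ℕ↑ m - ℕ↑ n                    ≈⟨ +-identityˡ _ ⟨
    0# + (ℕ↑ m - ℕ↑ n)             ≈⟨ +-congʳ (-‿inverseʳ 1#) ⟨
    (1# - 1#) + (ℕ↑ m - ℕ↑ n)      ≈⟨ interchange _ _ _ _ ⟩
    (1# + ℕ↑ m) + (- 1# - ℕ↑ n)    ≈⟨ +-congˡ (⁻¹-∙-comm 1# (ℕ↑ n)) ⟩
    (1# + ℕ↑ m) - (1# + ℕ↑ n)      ∎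

  ℤ↑-+ : ∀ i j → ℤ↑ (i ℤ.+ j) ≈ ℤ↑ i + ℤ↑ j
  ℤ↑-+ (+ m)    (+ n)    = ℕ↑-+ m n
  ℤ↑-+ (+ m)    -[1+ n ] = ℤ↑-⊖ m (suc n)
  ℤ↑-+ -[1+ m ] (+ n)    = trans (ℤ↑-⊖ n (suc m)) (+-comm _ _)
  ℤ↑-+ -[1+ m ] -[1+ n ] = begin
    - ℕ↑ (suc (suc (m ℕ.+ n)))      ≡⟨ ≡.cong (λ k → - ℕ↑ (suc k)) (ℕ.+-suc m n) ⟨
    - ℕ↑ (suc m ℕ.+ suc n)          ≈⟨ -‿cong (ℕ↑-+ (suc m) (suc n)) ⟩
    - (ℕ↑ (suc m) + ℕ↑ (suc n))     ≈⟨ ⁻¹-∙-comm _ _ ⟨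
    - ℕ↑ (suc m) - ℕ↑ (suc n)       ∎

  ℤ↑-◃⁺ : ∀ n → ℤ↑ (Sign.+ ◃ n) ≈ ℕ↑ n
  ℤ↑-◃⁺ zero    = refl
  ℤ↑-◃⁺ (suc n) = refl

  ℤ↑-◃⁻ : ∀ n → ℤ↑ (Sign.- ◃ n) ≈ - ℕ↑ n
  ℤ↑-◃⁻ zero    = sym ε⁻¹≈ε
  ℤ↑-◃⁻ (suc n) = refl

  ℤ↑-* : ∀ i j → ℤ↑ (i ℤ.* j) ≈ ℤ↑ i * ℤ↑ j
  ℤ↑-* (+ m) (+ n) = trans (ℤ↑-◃⁺ (m ℕ.* n)) (ℕ↑-* m n)
  ℤ↑-* (+ m) -[1+ n ] = begin
    ℤ↑ (Sign.- ◃ (m ℕ.* suc n))   ≈⟨ ℤ↑-◃⁻ (m ℕ.* suc n) ⟩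
    - ℕ↑ (m ℕ.* suc n)            ≈⟨ -‿cong (ℕ↑-* m (suc n)) ⟩
    - (ℕ↑ m * ℕ↑ (suc n))         ≈⟨ -‿distribʳ-* _ _ ⟩
    ℕ↑ m * - ℕ↑ (suc n)           ∎
  ℤ↑-* -[1+ m ] (+ n) = begin
    ℤ↑ (Sign.- ◃ (suc m ℕ.* n))   ≈⟨ ℤ↑-◃⁻ (suc m ℕ.* n) ⟩
    - ℕ↑ (suc m ℕ.* n)            ≈⟨ -‿cong (ℕ↑-* (suc m) n) ⟩
    - (ℕ↑ (suc m) * ℕ↑ n)         ≈⟨ -‿distribˡ-* _ _ ⟩
    - ℕ↑ (suc m) * ℕ↑ n           ∎
  ℤ↑-* -[1+ m ] -[1+ n ] = begin
    ℤ↑ (Sign.+ ◃ (suc m ℕ.* suc n))   ≈⟨ ℤ↑-◃⁺ (suc m ℕ.* suc n) ⟩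
    ℕ↑ (suc m ℕ.* suc n)              ≈⟨ ℕ↑-* (suc m) (suc n) ⟩
    ℕ↑ (suc m) * ℕ↑ (suc n)           ≈⟨ ⁻¹-involutive _ ⟨
    - - (ℕ↑ (suc m) * ℕ↑ (suc n))     ≈⟨ -‿cong (-‿distribˡ-* _ _) ⟩
    - (- ℕ↑ (suc m) * ℕ↑ (suc n))     ≈⟨ -‿distribʳ-* _ _ ⟩
    - ℕ↑ (suc m) * - ℕ↑ (suc n)       ∎

  ℤ↑-neg : ∀ i → ℤ↑ (ℤ.- i) ≈ - ℤ↑ i
  ℤ↑-neg (+ zero)  = sym ε⁻¹≈ε
  ℤ↑-neg (+ suc n) = refl
  ℤ↑-neg -[1+ n ]  = sym (⁻¹-involutive _)

  ℤ↑-homomorphism : ℤ.+-*-rawRing -Raw-AlmostCommutative⟶ fromCommutativeRing commRing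
  ℤ↑-homomorphism = record
    { ⟦_⟧ = ℤ↑ ; +-homo = ℤ↑-+ ; *-homo = ℤ↑-* ; -‿homo = ℤ↑-neg
    ; 0-homo = refl ; 1-homo = +-identityʳ 1# }

  ℤ↑-≟ : ∀ i j → Maybe (ℤ↑ i ≈ ℤ↑ j)
  ℤ↑-≟ i j with i ℤ.≟ j
  ... | yes ≡.refl = just refl
  ... | no _       = nothing

  -- ℤ↑ (+ 1) reduces to 1# + 0#, not 1#: solver goals mention 1# either in that
  -- form or as an atom.
  open import Algebra.Solver.Ring ℤ.+-*-rawRing (fromCommutativeRing commRing)
    ℤ↑-homomorphism ℤ↑-≟ using (solve; _:=_; _:+_; _:*_; _:-_; _:^_; con)

  ^-congˡ : ∀ {x y} n → x ≈ y → x ^ n ≈ y ^ n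
  ^-congˡ zero    x≈y = refl
  ^-congˡ (suc n) x≈y = *-cong x≈y (^-congˡ n x≈y)

  ^-zeroˡ : ∀ n → 1# ^ n ≈ 1#
  ^-zeroˡ zero    = refl
  ^-zeroˡ (suc n) = trans (*-identityˡ _) (^-zeroˡ n)

  ^-distribˡ-+-* : ∀ x m n → x ^ (m ℕ.+ n) ≈ x ^ m * x ^ n
  ^-distribˡ-+-* x zero    n = sym (*-identityˡ _)
  ^-distribˡ-+-* x (suc m) n = trans (*-congˡ (^-distribˡ-+-* x m n)) (sym (*-assoc _ _ _))

  [xᵐ]ⁿ≈xⁿᵐ : ∀ x m n → (x ^ m) ^ n ≈ x ^ (n ℕ.* m)
  [xᵐ]ⁿ≈xⁿᵐ x m zero    = refl
  [xᵐ]ⁿ≈xⁿᵐ x m (suc n) = trans (*-congˡ ([xᵐ]ⁿ≈xⁿᵐ x m n)) (sym (^-distribˡ-+-* x m (n ℕ.* m)))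

  [xᵐ]ⁿ≈xᵐⁿ : ∀ x m n → (x ^ m) ^ n ≈ x ^ (m ℕ.* n)
  [xᵐ]ⁿ≈xᵐⁿ x m n = trans ([xᵐ]ⁿ≈xⁿᵐ x m n) (reflexive (≡.cong (x ^_) (ℕ.*-comm n m)))

  ^-distrib-* : ∀ x y n → (x * y) ^ n ≈ x ^ n * y ^ n
  ^-distrib-* x y zero    = sym (*-identityˡ 1#)
  ^-distrib-* x y (suc n) = begin
    (x * y) * (x * y) ^ n        ≈⟨ *-congˡ (^-distrib-* x y n) ⟩
    (x * y) * (x ^ n * y ^ n)    ≈⟨ *.interchange x y (x ^ n) (y ^ n) ⟩
    (x * x ^ n) * (y * y ^ n)    ∎

  x*y≈z⇒x≈z*y⁻¹ : ∀ {x y z} → x * y ≈ z → ¬ (y ≈ 0#) → x ≈ z * y ⁻¹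
  x*y≈z⇒x≈z*y⁻¹ {x} {y} {z} x*y≈z y≉0 = begin
    x               ≈⟨ *-identityʳ x ⟨
    x * 1#          ≈⟨ *-congˡ (inverse y y≉0) ⟨
    x * (y * y ⁻¹)  ≈⟨ *-assoc x y (y ⁻¹) ⟨
    x * y * y ⁻¹    ≈⟨ *-congʳ x*y≈z ⟩
    z * y ⁻¹        ∎

  rootOfUnity≉0 : ∀ {w n} → 1 ℕ.≤ n → w ^ n ≈ 1# → ¬ (w ≈ 0#)
  rootOfUnity≉0 {w} {suc n} _ wⁿ≈1 w≈0 = 0≉1 (begin
    0#            ≈⟨ zeroˡ (w ^ n) ⟨
    0# * w ^ n    ≈⟨ *-congʳ w≈0 ⟨
    w ^ suc n     ≈⟨ wⁿ≈1 ⟩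
    1#            ∎)

  rootOfUnity-⁻¹ : ∀ {w n} → 1 ℕ.≤ n → w ^ n ≈ 1# → (w ⁻¹) ^ n ≈ 1#
  rootOfUnity-⁻¹ {w} {n} 1≤n wⁿ≈1 = begin
    (w ⁻¹) ^ n              ≈⟨ *-identityʳ _ ⟨
    (w ⁻¹) ^ n * 1#         ≈⟨ *-congˡ wⁿ≈1 ⟨
    (w ⁻¹) ^ n * w ^ n      ≈⟨ ^-distrib-* (w ⁻¹) w n ⟨
    (w ⁻¹ * w) ^ n          ≈⟨ ^-congˡ n (trans (*-comm _ _) (inverse w (rootOfUnity≉0 1≤n wⁿ≈1))) ⟩
    1# ^ n                  ≈⟨ ^-zeroˡ n ⟩
    1#                      ∎

  rootOfUnity-^ : ∀ {y n} m → y ^ n ≈ 1# → (y ^ m) ^ n ≈ 1#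
  rootOfUnity-^ {y} {n} m yⁿ≈1 = begin
    (y ^ m) ^ n        ≈⟨ [xᵐ]ⁿ≈xⁿᵐ y m n ⟩
    y ^ (n ℕ.* m)      ≈⟨ [xᵐ]ⁿ≈xᵐⁿ y n m ⟨
    (y ^ n) ^ m        ≈⟨ ^-congˡ m yⁿ≈1 ⟩
    1# ^ m             ≈⟨ ^-zeroˡ m ⟩
    1#                 ∎

  Σ-cong : ∀ {n} {f h : Fin n → Carrier} → (∀ k → f k ≈ h k) → Σ f ≈ Σ h
  Σ-cong {zero}  f≈h = refl
  Σ-cong {suc n} f≈h = +-cong (f≈h Fin.zero) (Σ-cong (λ k → f≈h (Fin.suc k)))

  *-distribˡ-Σ : ∀ {n} x (f : Fin n → Carrier) → x * Σ f ≈ Σ (λ k → x * f k)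
  *-distribˡ-Σ {zero}  x f = zeroʳ x
  *-distribˡ-Σ {suc n} x f = trans (distribˡ _ _ _) (+-congˡ (*-distribˡ-Σ x (λ k → f (Fin.suc k))))

  circEigenvalue≈Σ[aₖxᵏ] : ∀ {n} (a : Fin n → Carrier) w j →
    circEigenvalue a w j ≈ Σ (λ k → a k * ((w ⁻¹) ^ toℕ j) ^ toℕ k)
  circEigenvalue≈Σ[aₖxᵏ] {n} a w j =
    Σ-cong {n} (λ k → *-congˡ {a k} (sym ([xᵐ]ⁿ≈xᵐⁿ (w ⁻¹) (toℕ j) (toℕ k))))

  G-rec : ∀ P Q R a → ℤ↑ (G P Q R (3 ℕ.+ a))
    ≈ ℤ↑ P * ℤ↑ (G P Q R (2 ℕ.+ a)) + ℤ↑ Q * ℤ↑ (G P Q R (1 ℕ.+ a)) + ℤ↑ R * ℤ↑ (G P Q R a)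
  G-rec P Q R a =
    trans (ℤ↑-+ (P ℤ.* G₂ ℤ.+ Q ℤ.* G₁) (R ℤ.* G₀))
          (+-cong (trans (ℤ↑-+ (P ℤ.* G₂) (Q ℤ.* G₁)) (+-cong (ℤ↑-* P G₂) (ℤ↑-* Q G₁))) (ℤ↑-* R G₀))
    where
    G₀ = G P Q R a
    G₁ = G P Q R (suc a)
    G₂ = G P Q R (suc (suc a))

  module Telescoping
    (p q r : Carrier) (g : ℕ → Carrier)
    (g-rec : ∀ a → g (3 ℕ.+ a) ≈ p * g (2 ℕ.+ a) + q * g (1 ℕ.+ a) + r * g a)
    (x : Carrier) where

    denominator : Carrier
    denominator = p * x + q * x ^ 2 + r * x ^ 3 - 1#

    numerator : ℕ → Carrier
    numerator a = g (suc a) + (g (suc (suc a)) - p * g (suc a)) * x + r * g a * x ^ 2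

    partialSum : ℕ → ℕ → Carrier
    partialSum a m = Σ {m} (λ k → g (a ℕ.+ suc (toℕ k)) * x ^ toℕ k)

    numerator-step : ∀ a → g (suc a) * denominator ≈ x * numerator (suc a) - numerator a
    numerator-step a = begin
      g₁ * denominator
        ≈⟨ *-congˡ (+-congˡ (-‿cong (+-identityʳ 1#))) ⟨
      g₁ * (p * x + q * x ^ 2 + r * x ^ 3 - (1# + 0#))
        ≈⟨ solve 7 (λ x p q r g₀ g₁ g₂ →
             g₁ :* (p :* x :+ q :* x :^ 2 :+ r :* x :^ 3 :- con (ℤ.+ 1))
             := x :* (g₂ :+ ((p :* g₂ :+ q :* g₁ :+ r :* g₀) :- p :* g₂) :* x :+ r :* g₁ :* x :^ 2)
                :- (g₁ :+ (g₂ :- p :* g₁) :* x :+ r :* g₀ :* x :^ 2))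
             refl x p q r g₀ g₁ g₂ ⟩
      x * (g₂ + ((p * g₂ + q * g₁ + r * g₀) - p * g₂) * x + r * g₁ * x ^ 2) - numerator a
        ≈⟨ +-congʳ (*-congˡ (+-congʳ (+-congˡ (*-congʳ (+-congʳ (g-rec a)))))) ⟨
      x * numerator (suc a) - numerator a ∎
      where
      g₀ = g a
      g₁ = g (suc a)
      g₂ = g (suc (suc a))

    partialSum-suc : ∀ a m → partialSum a (suc m) ≈ g (suc a) + x * partialSum (suc a) m
    partialSum-suc a m = +-cong head (trans (Σ-cong shift) (sym (*-distribˡ-Σ {m} x (λ k → g (suc a ℕ.+ suc (toℕ k)) * x ^ toℕ k))))
      where
      head : g (a ℕ.+ 1) * 1# ≈ g (suc a)
      head = trans (*-identityʳ _) (reflexive (≡.cong g (ℕ.+-comm a 1)))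
      shift : ∀ (k : Fin m) → g (a ℕ.+ suc (suc (toℕ k))) * (x * x ^ toℕ k)
                            ≈ x * (g (suc a ℕ.+ suc (toℕ k)) * x ^ toℕ k)
      shift k = trans (*-congʳ (reflexive (≡.cong g (ℕ.+-suc a (suc (toℕ k))))))
                      (*.x∙yz≈y∙xz _ x _)

    partialSum*denominator : ∀ m a →
      partialSum a m * denominator ≈ x ^ m * numerator (a ℕ.+ m) - numerator a
    partialSum*denominator zero a = begin
      0# * denominator                      ≈⟨ zeroˡ denominator ⟩
      0#                                    ≈⟨ -‿inverseʳ (numerator a) ⟨
      numerator a - numerator a             ≈⟨ +-congʳ (*-identityˡ _) ⟨
      1# * numerator a - numerator a        ≡⟨ ≡.cong (λ b → 1# * numerator b - numerator a) (ℕ.+-identityʳ a) ⟨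
      1# * numerator (a ℕ.+ 0) - numerator a ∎
    partialSum*denominator (suc m) a = begin
      partialSum a (suc m) * denominator
        ≈⟨ *-congʳ (partialSum-suc a m) ⟩
      (g (suc a) + x * s) * denominator
        ≈⟨ trans (distribʳ _ _ _) (+-congˡ (*-assoc _ _ _)) ⟩
      g (suc a) * denominator + x * (s * denominator)
        ≈⟨ +-cong (numerator-step a) (*-congˡ (partialSum*denominator m (suc a))) ⟩
      (x * v₁ - v₀) + x * (x ^ m * v - v₁)
        ≈⟨ solve 5 (λ x xᵐ v v₀ v₁ → (x :* v₁ :- v₀) :+ x :* (xᵐ :* v :- v₁) := x :* xᵐ :* v :- v₀)
             refl x (x ^ m) v v₀ v₁ ⟩
      x ^ suc m * v - v₀
        ≡⟨ ≡.cong (λ b → x ^ suc m * numerator b - v₀) (ℕ.+-suc a m) ⟨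
      x ^ suc m * numerator (a ℕ.+ suc m) - v₀ ∎
      where
      s = partialSum (suc a) m
      v = numerator (suc a ℕ.+ m)
      v₀ = numerator a
      v₁ = numerator (suc a)

    partialSum-closedForm : ∀ {m} → x ^ m ≈ 1# → g 0 ≈ 0# → g 1 ≈ 0# → g 2 ≈ 1# →
      partialSum 0 m * denominator
        ≈ g (suc m) + (g (suc (suc m)) - p * g (suc m) - 1#) * x + r * g m * x ^ 2
    partialSum-closedForm {m} xᵐ≈1 g₀≈0 g₁≈0 g₂≈1 = begin
      partialSum 0 m * denominator   ≈⟨ partialSum*denominator m 0 ⟩
      x ^ m * numerator m - numerator 0
        ≈⟨ +-cong (trans (*-congʳ xᵐ≈1) (*-identityˡ _)) (-‿cong numerator₀≈x) ⟩
      numerator m - x                ≈⟨ +-congˡ (-‿cong (*-identityˡ x)) ⟨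
      numerator m - 1# * x
        ≈⟨ solve 7 (λ x p r g₀ g₁ g₂ o →
             g₁ :+ (g₂ :- p :* g₁) :* x :+ r :* g₀ :* x :^ 2 :- o :* x
             := g₁ :+ (g₂ :- p :* g₁ :- o) :* x :+ r :* g₀ :* x :^ 2)
             refl x p r (g m) (g (suc m)) (g (suc (suc m))) 1# ⟩
      g (suc m) + (g (suc (suc m)) - p * g (suc m) - 1#) * x + r * g m * x ^ 2 ∎
      where
      numerator₀≈x : numerator 0 ≈ x
      numerator₀≈x = begin
        numerator 0
          ≈⟨ +-cong (+-cong g₁≈0 (*-congʳ (+-cong g₂≈1 (-‿cong (*-congˡ g₁≈0)))))
                    (*-congʳ (*-congˡ g₀≈0)) ⟩
        0# + (1# - p * 0#) * x + r * 0# * x ^ 2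
          ≈⟨ solve 4 (λ x p r o → con (ℤ.+ 0) :+ (o :- p :* con (ℤ.+ 0)) :* x
                                  :+ r :* con (ℤ.+ 0) :* x :^ 2 := o :* x)
               refl x p r 1# ⟩
        1# * x  ≈⟨ *-identityˡ x ⟩
        x       ∎

theorem4 : ∀ {c ℓ : Level} (F : Field c ℓ) →
  let open Field F
      open FieldOps F
  in CharZero →
     (P Q R : ℤ) (n : ℕ) → 1 ℕ.≤ n →
     (w : Carrier) → PrimitiveRoot n w →
     (j : Fin n) →
     let g : ℕ → Carrier
         g m = ℤ↑ (G P Q R m)
         w⁻ʲ : ℕ → Carrier
         w⁻ʲ k = (w ⁻¹) ^ (k ℕ.* toℕ j)
         D : Carrier
         D = ℤ↑ P * w⁻ʲ 1 + ℤ↑ Q * w⁻ʲ 2 + ℤ↑ R * w⁻ʲ 3 - 1#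
     in ¬ (D ≈ 0#) →
        circEigenvalue (λ k → g (ℕ.suc (toℕ k))) w j
          ≈ (g (n ℕ.+ 1) + (g (n ℕ.+ 2) - ℤ↑ P * g (n ℕ.+ 1) - 1#) * w⁻ʲ 1
               + ℤ↑ R * g n * w⁻ʲ 2) * (D ⁻¹)
theorem4 F _ P Q R n 1≤n w (wⁿ≈1 , _) j D≉0 = x*y≈z⇒x≈z*y⁻¹ (begin
    circEigenvalue (λ k → g (suc (toℕ k))) w j * D
      ≈⟨ *-cong (circEigenvalue≈Σ[aₖxᵏ] _ w j) (sym denominator≈D) ⟩
    partialSum 0 n * denominator
      ≈⟨ partialSum-closedForm {n} xⁿ≈1 refl refl (+-identityʳ 1#) ⟩
    g (suc n) + (g (suc (suc n)) - p * g (suc n) - 1#) * x + r * g n * x ^ 2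
      ≈⟨ closedForm≈numerator ⟩
    g (n ℕ.+ 1) + (g (n ℕ.+ 2) - p * g (n ℕ.+ 1) - 1#) * w⁻ʲ 1 + r * g n * w⁻ʲ 2 ∎) D≉0
  where
  open Field F hiding (zero)
  open FieldOps F
  open FieldTheory F
  open import Relation.Binary.Reasoning.Setoid setoid
  p = ℤ↑ P
  r = ℤ↑ R
  g : ℕ → Carrier
  g m = ℤ↑ (G P Q R m)
  w⁻ʲ : ℕ → Carrier
  w⁻ʲ k = (w ⁻¹) ^ (k ℕ.* toℕ j)
  x = (w ⁻¹) ^ toℕ j
  D = p * w⁻ʲ 1 + ℤ↑ Q * w⁻ʲ 2 + r * w⁻ʲ 3 - 1#
  open Telescoping p (ℤ↑ Q) r g (G-rec P Q R) x

  xⁿ≈1 : x ^ n ≈ 1#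
  xⁿ≈1 = rootOfUnity-^ {n = n} (toℕ j) (rootOfUnity-⁻¹ 1≤n wⁿ≈1)

  xᵏ≈w⁻ʲᵏ : ∀ k → x ^ k ≈ w⁻ʲ k
  xᵏ≈w⁻ʲᵏ = [xᵐ]ⁿ≈xⁿᵐ (w ⁻¹) (toℕ j)

  x≈w⁻ʲ : x ≈ w⁻ʲ 1
  x≈w⁻ʲ = trans (sym (*-identityʳ x)) (xᵏ≈w⁻ʲᵏ 1)

  denominator≈D : denominator ≈ D
  denominator≈D = +-congʳ (+-cong (+-cong (*-congˡ x≈w⁻ʲ) (*-congˡ (xᵏ≈w⁻ʲᵏ 2))) (*-congˡ (xᵏ≈w⁻ʲᵏ 3)))

  closedForm≈numerator : g (suc n) + (g (suc (suc n)) - p * g (suc n) - 1#) * x + r * g n * x ^ 2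
    ≈ g (n ℕ.+ 1) + (g (n ℕ.+ 2) - p * g (n ℕ.+ 1) - 1#) * w⁻ʲ 1 + r * g n * w⁻ʲ 2
  closedForm≈numerator rewrite ℕ.+-comm n 1 | ℕ.+-comm n 2 =
    +-cong (+-congˡ (*-congˡ x≈w⁻ʲ)) (*-congˡ (xᵏ≈w⁻ʲᵏ 2))
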